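{- Let $n\ge3$ and let $x$ be a position of Exco-Nim with parameter $n$. Put $\mathcal{L}(x)=\{(m(x'),u(x')) : x\to x' \text{ is a legal move}\}$. Then for nonnegative integers $m,u$, we have $(m,u)\in\mathcal{L}(x)$ if and only if both (i) $m\le m(x)$, and moreover $m<m(x)$ if $y(x)=0$; and (ii) $m(x)+(n-1)m\le u\le u(x)-\max\{1,\,m(x)-m\}$.
   Context: Exco-Nim with parameter $n$: positions are tuples $x=(x_0,x_1,\ldots,x_n)$ of nonnegative integers. A legal move $x\to x'$ is to a tuple $x'$ of nonnegative integers with $x'_j\le x_j$ for all $j$, $\sum_j x'_j<\sum_j x_j$, and $x'_i=x_i$ for at least one index $1\le i\le n$. For a position $x$: $m(x)=\min_{1\le i\le n}x_i$, $u(x)=\sum_{i=0}^n x_i$, $y(x)=u(x)-n\,m(x)$. -}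

module Defs where

open import Data.Nat using (ℕ; zero; suc; _+_; _*_; _∸_; _≤_; _<_; _⊓_; _⊔_)
open import Data.Fin using (Fin; zero; suc)
open import Data.Product using (Σ; _×_; ∃-syntax)

-- A position of Exco-Nim with parameter n: a tuple (x_0, x_1, ..., x_n),
-- represented as a function Fin (suc n) → ℕ; index 0 is x_0,
-- index (suc i) is x_{i+1}.
Position : ℕ → Set
Position n = Fin (suc n) → ℕ

sumF : ∀ {k} → (Fin k → ℕ) → ℕ
sumF {zero}  f = 0
sumF {suc k} f = f zero + sumF (λ i → f (suc i))

minF : ∀ {k} → (Fin (suc k) → ℕ) → ℕ
minF {zero}  f = f zero
minF {suc k} f = f zero ⊓ minF (λ i → f (suc i))

-- m(x) = min_{1 ≤ i ≤ n} x_i   (meaningful for n ≥ 1; the statement uses n ≥ 3;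
-- for n = 0 the empty minimum is set to 0 as a harmless convention)
mOf : ∀ {n} → Position n → ℕ
mOf {zero}  x = 0
mOf {suc n} x = minF (λ i → x (suc i))

uOf : ∀ {n} → Position n → ℕ
uOf x = sumF x

-- y(x) = u(x) - n m(x)  (always ≥ 0, so truncated subtraction is exact)
yOf : ∀ {n} → Position n → ℕ
yOf {n} x = uOf x ∸ (n * mOf x)

LegalMove : ∀ {n} → Position n → Position n → Set
LegalMove {n} x x' =
  ((j : Fin (suc n)) → x' j ≤ x j)
  × (uOf x' < uOf x)
  × (∃[ i ] x' (suc i) ≡ x (suc i))
  where open import Relation.Binary.PropositionalEquality using (_≡_)

InL : ∀ {n} → Position n → ℕ → ℕ → Set
InL {n} x m u = ∃[ x' ] (LegalMove x x' × mOf x' ≡ m × uOf x' ≡ u)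
  where open import Relation.Binary.PropositionalEquality using (_≡_)

module Submission where

-- Write a position as x = (x₀, t) with t = (x₁, …, xₙ), M = min t = m(x) and
-- U = x₀ + Σ t = u(x).
--
-- Necessity.  If x → x' is legal with m' = m(x'), u' = u(x'), then
--   * m' ≤ M, because the minimum is monotone;
--   * M + (n-1)m' ≤ u', because a kept coordinate x'ᵢ = xᵢ is ≥ M and the
--     other n-1 coordinates of t' are ≥ m';
--   * u' + (M - m') ≤ U, because at an index j where t' attains m' the
--     coordinate dropped by tⱼ - m' ≥ M - m'; together with u' < U this is
--     u' + max(1, M - m') ≤ U;
--   * if y(x) = 0, i.e. U = nM, then m' = M would force u' ≥ nM = U.
-- Sufficiency.  The general construction (moveKeeping) realises (m,u) by a
-- move keeping coordinate i and lowering a coordinate l ≠ i to m, whenever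
-- tᵢ + (n-1)m ≤ u ≤ U - (t_l - m) and u < U: the target sum is distributed
-- between a lower and an upper profile (fill).  Choosing i = argmin t and
-- l = the second smallest index, or the other way round, covers every case;
-- the second choice is where n ≥ 3 is used.

open import Defs
open import Data.Nat using (ℕ; zero; suc; _+_; _*_; _∸_; _≤_; _<_; _⊓_; _⊔_; z≤n; s≤s; _≤?_; _<?_)
open import Data.Nat.Properties hiding (_≟_)
open import Data.Nat.Solver using (module +-*-Solver)
open import Data.Fin using (Fin; zero; suc; punchIn; punchOut; _≟_)
open import Data.Fin.Properties using (punchInᵢ≢i; punchIn-punchOut)
open import Data.Vec.Functional using (updateAt; removeAt; _∷_)
open import Data.Vec.Functional.Properties using (updateAt-updates; updateAt-minimal)
open import Data.Product using (_×_; _,_; ∃-syntax; proj₁; proj₂)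
open import Data.Sum using (inj₁; inj₂)
open import Relation.Binary.PropositionalEquality
open import Relation.Nullary using (yes; no)
open import Relation.Nullary.Negation using (contradiction)
open import Function using (_∘_)
open import Function.Bundles using (_⇔_; mk⇔)

open +-*-Solver using (solve; _:+_; _:*_; _:=_; con)

private
  variable
    k : ℕ

_[_]≔_ : (Fin k → ℕ) → Fin k → ℕ → Fin k → ℕ
f [ j ]≔ v = updateAt f j (λ _ → v)

updated-all : (P : Fin k → ℕ → Set) (f : Fin k → ℕ) (j : Fin k) (v : ℕ) →
              P j v → (∀ i → i ≢ j → P i (f i)) → ∀ i → P i ((f [ j ]≔ v) i)
updated-all P f j v pj pf i with i ≟ j
... | yes refl = subst (P i) (sym (updateAt-updates i f)) pj
... | no i≢j   = subst (P i) (sym (updateAt-minimal i j f i≢j)) (pf i i≢j)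

sum-mono : (f g : Fin k → ℕ) → (∀ i → f i ≤ g i) → sumF f ≤ sumF g
sum-mono {zero}  f g f≤g = z≤n
sum-mono {suc k} f g f≤g =
  +-mono-≤ (f≤g zero) (sum-mono (f ∘ suc) (g ∘ suc) (f≤g ∘ suc))

sum-cong : (f g : Fin k → ℕ) → (∀ i → f i ≡ g i) → sumF f ≡ sumF g
sum-cong {zero}  f g f≡g = refl
sum-cong {suc k} f g f≡g = cong₂ _+_ (f≡g zero) (sum-cong (f ∘ suc) (g ∘ suc) (f≡g ∘ suc))

sum-const : ∀ k c → sumF {k} (λ _ → c) ≡ k * c
sum-const zero    c = refl
sum-const (suc k) c = cong (c +_) (sum-const k c)

sum-+ : (f g : Fin k → ℕ) → sumF (λ i → f i + g i) ≡ sumF f + sumF g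
sum-+ {zero}  f g = refl
sum-+ {suc k} f g = begin
  f zero + g zero + sumF (λ i → f (suc i) + g (suc i))
    ≡⟨ cong (f zero + g zero +_) (sum-+ (f ∘ suc) (g ∘ suc)) ⟩
  f zero + g zero + (sumF (f ∘ suc) + sumF (g ∘ suc))
    ≡⟨ solve 4 (λ a b c d → a :+ b :+ (c :+ d) := a :+ c :+ (b :+ d)) refl
               (f zero) (g zero) (sumF (f ∘ suc)) (sumF (g ∘ suc)) ⟩
  f zero + sumF (f ∘ suc) + (g zero + sumF (g ∘ suc)) ∎
  where open ≡-Reasoning

sum-update : (f : Fin k → ℕ) (j : Fin k) (v : ℕ) →
             sumF (f [ j ]≔ v) + f j ≡ sumF f + v
sum-update {suc k} f zero v =
  solve 3 (λ v s a → v :+ s :+ a := a :+ s :+ v) refl v (sumF (f ∘ suc)) (f zero)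
sum-update {suc k} f (suc j) v = begin
  f zero + sumF ((f ∘ suc) [ j ]≔ v) + f (suc j)
    ≡⟨ +-assoc (f zero) _ _ ⟩
  f zero + (sumF ((f ∘ suc) [ j ]≔ v) + f (suc j))
    ≡⟨ cong (f zero +_) (sum-update (f ∘ suc) j v) ⟩
  f zero + (sumF (f ∘ suc) + v)
    ≡⟨ +-assoc (f zero) _ v ⟨
  f zero + sumF (f ∘ suc) + v ∎
  where open ≡-Reasoning

sum-update-const : ∀ k c (j : Fin (suc k)) v → sumF ((λ _ → c) [ j ]≔ v) ≡ v + k * c
sum-update-const k c j v = +-cancelʳ-≡ c _ _ (begin
  sumF ((λ _ → c) [ j ]≔ v) + c ≡⟨ sum-update (λ _ → c) j v ⟩
  sumF {suc k} (λ _ → c) + v  ≡⟨ cong (_+ v) (sum-const (suc k) c) ⟩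
  c + k * c + v               ≡⟨ solve 3 (λ c kc v → c :+ kc :+ v := v :+ kc :+ c) refl c (k * c) v ⟩
  v + k * c + c               ∎)
  where open ≡-Reasoning

sum-lowered : (f : Fin k → ℕ) (j : Fin k) (v : ℕ) → v ≤ f j →
              sumF (f [ j ]≔ v) + (f j ∸ v) ≡ sumF f
sum-lowered f j v v≤fj = +-cancelʳ-≡ v _ _ (begin
  sumF (f [ j ]≔ v) + (f j ∸ v) + v ≡⟨ +-assoc (sumF (f [ j ]≔ v)) _ v ⟩
  sumF (f [ j ]≔ v) + (f j ∸ v + v) ≡⟨ cong (sumF (f [ j ]≔ v) +_) (m∸n+n≡m v≤fj) ⟩
  sumF (f [ j ]≔ v) + f j           ≡⟨ sum-update f j v ⟩
  sumF f + v                        ∎)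
  where open ≡-Reasoning

sum-lower : (f : Fin (suc k) → ℕ) (j : Fin (suc k)) (c : ℕ) →
            (∀ i → i ≢ j → c ≤ f i) → f j + k * c ≤ sumF f
sum-lower {k} f j c c≤f = begin
  f j + k * c                 ≡⟨ sum-update-const k c j (f j) ⟨
  sumF ((λ _ → c) [ j ]≔ f j) ≤⟨ sum-mono _ f (updated-all (λ i v → v ≤ f i) (λ _ → c) j (f j) ≤-refl c≤f) ⟩
  sumF f                      ∎
  where open ≤-Reasoning

sum-drop : (f' f : Fin k → ℕ) → (∀ i → f' i ≤ f i) → ∀ j → sumF f' + (f j ∸ f' j) ≤ sumF f
sum-drop f' f f'≤f j = begin
  sumF f' + (f j ∸ f' j)                ≤⟨ +-monoˡ-≤ _ (sum-mono f' _ f'≤new) ⟩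
  sumF (f [ j ]≔ f' j) + (f j ∸ f' j)  ≡⟨ sum-lowered f j (f' j) (f'≤f j) ⟩
  sumF f                                ∎
  where
    open ≤-Reasoning
    f'≤new : ∀ i → f' i ≤ (f [ j ]≔ f' j) i
    f'≤new = updated-all (λ i v → f' i ≤ v) f j (f' j) ≤-refl (λ i _ → f'≤f i)

split-below : (g : Fin k → ℕ) (d : ℕ) → d ≤ sumF g →
              ∃[ e ] (∀ i → e i ≤ g i) × sumF e ≡ d
split-below {zero}  g d d≤0 = (λ ()) , (λ ()) , sym (n≤0⇒n≡0 d≤0)
split-below {suc k} g d d≤Σg
  with split-below (g ∘ suc) (d ∸ g zero) (m≤n+o⇒m∸n≤o d (g zero) d≤Σg)
... | e , e≤g , Σe≡ = (g zero ⊓ d) ∷ e , bounded ,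
                      trans (cong (g zero ⊓ d +_) Σe≡) (m⊓n+n∸m≡n (g zero) d)
  where
    bounded : ∀ i → ((g zero ⊓ d) ∷ e) i ≤ g i
    bounded zero    = m⊓n≤m (g zero) d
    bounded (suc i) = e≤g i

fill : (lo hi : Fin k → ℕ) → (∀ i → lo i ≤ hi i) → (s : ℕ) → sumF lo ≤ s → s ≤ sumF hi →
       ∃[ f ] (∀ i → lo i ≤ f i) × (∀ i → f i ≤ hi i) × sumF f ≡ s
fill lo hi lo≤hi s Σlo≤s s≤Σhi
  with split-below gap (s ∸ sumF lo) (m≤n+o⇒m∸n≤o s (sumF lo) s≤Σlo+Σgap)
  where
    gap : Fin _ → ℕ
    gap i = hi i ∸ lo i
    Σlo+Σgap : sumF lo + sumF gap ≡ sumF hi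
    Σlo+Σgap = trans (sym (sum-+ lo gap)) (sum-cong _ hi (λ i → m+[n∸m]≡n (lo≤hi i)))
    s≤Σlo+Σgap : s ≤ sumF lo + sumF gap
    s≤Σlo+Σgap = subst (s ≤_) (sym Σlo+Σgap) s≤Σhi
... | e , e≤gap , Σe≡ =
  (λ i → lo i + e i) ,
  (λ i → m≤m+n (lo i) (e i)) ,
  (λ i → ≤-trans (+-monoʳ-≤ (lo i) (e≤gap i)) (≤-reflexive (m+[n∸m]≡n (lo≤hi i)))) ,
  trans (sum-+ lo e) (trans (cong (sumF lo +_) Σe≡) (m+[n∸m]≡n Σlo≤s))

minF-le : (f : Fin (suc k) → ℕ) (i : Fin (suc k)) → minF f ≤ f i
minF-le {zero}  f zero    = ≤-refl
minF-le {suc k} f zero    = m⊓n≤m _ _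
minF-le {suc k} f (suc i) = ≤-trans (m⊓n≤n _ _) (minF-le (f ∘ suc) i)

minF-glb : (f : Fin (suc k) → ℕ) (c : ℕ) → (∀ i → c ≤ f i) → c ≤ minF f
minF-glb {zero}  f c c≤f = c≤f zero
minF-glb {suc k} f c c≤f = ⊓-glb (c≤f zero) (minF-glb (f ∘ suc) c (c≤f ∘ suc))

minF-mono : (f g : Fin (suc k) → ℕ) → (∀ i → f i ≤ g i) → minF f ≤ minF g
minF-mono f g f≤g = minF-glb g (minF f) (λ i → ≤-trans (minF-le f i) (f≤g i))

argmin : (f : Fin (suc k) → ℕ) → ∃[ i ] f i ≡ minF f
argmin {zero}  f = zero , refl
argmin {suc k} f with ≤-total (f zero) (minF (f ∘ suc)) | argmin (f ∘ suc)
... | inj₁ f0≤ | _      = zero , sym (m≤n⇒m⊓n≡m f0≤)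
... | inj₂ ≤f0 | i , eq = suc i , trans eq (sym (m≥n⇒m⊓n≡n ≤f0))

argmin-except : (f : Fin (suc (suc k)) → ℕ) (a : Fin (suc (suc k))) →
                ∃[ j ] j ≢ a × (∀ i → i ≢ a → f j ≤ f i)
argmin-except f a with argmin (removeAt f a)
... | r , eq = punchIn a r , punchInᵢ≢i a r , smallest
  where
    smallest : ∀ i → i ≢ a → f (punchIn a r) ≤ f i
    smallest i i≢a = begin
      f (punchIn a r)                      ≡⟨ eq ⟩
      minF (removeAt f a)                  ≤⟨ minF-le (removeAt f a) (punchOut (i≢a ∘ sym)) ⟩
      f (punchIn a (punchOut (i≢a ∘ sym))) ≡⟨ cong f (punchIn-punchOut (i≢a ∘ sym)) ⟩
      f i                                  ∎
      where open ≤-Reasoning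

coords : Position (suc k) → Fin (suc k) → ℕ
coords x = x ∘ suc

Admissible : (n : ℕ) → Position n → ℕ → ℕ → Set
Admissible n x m u =
  (m ≤ mOf x × (yOf x ≡ 0 → m < mOf x))
  × (mOf x + (n ∸ 1) * m ≤ u × u + (1 ⊔ (mOf x ∸ m)) ≤ uOf x)

max-bound-intro : ∀ u d U → u < U → u + d ≤ U → u + (1 ⊔ d) ≤ U
max-bound-intro u d U u<U u+d≤U =
  subst (_≤ U) (sym (+-distribˡ-⊔ u 1 d)) (⊔-lub (subst (_≤ U) (+-comm 1 u) u<U) u+d≤U)

max-bound-strict : ∀ u d U → u + (1 ⊔ d) ≤ U → u < U
max-bound-strict u d U bound =
  ≤-trans (≤-reflexive (+-comm 1 u)) (≤-trans (+-monoʳ-≤ u (m≤m⊔n 1 d)) bound)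

max-bound-gap : ∀ u d U → u + (1 ⊔ d) ≤ U → u + d ≤ U
max-bound-gap u d U bound = ≤-trans (+-monoʳ-≤ u (m≤n⊔m 1 d)) bound

module Necessity {k : ℕ} (x x' : Position (suc k)) (legal : LegalMove x x') where
  private
    x'≤x : ∀ j → x' j ≤ x j
    x'≤x = proj₁ legal
    u'<u : uOf x' < uOf x
    u'<u = proj₁ (proj₂ legal)
    i : Fin (suc k)
    i = proj₁ (proj₂ (proj₂ legal))
    kept : x' (suc i) ≡ x (suc i)
    kept = proj₂ (proj₂ (proj₂ legal))

  min-decreases : mOf x' ≤ mOf x
  min-decreases = minF-mono (coords x') (coords x) (x'≤x ∘ suc)

  -- A kept coordinate is ≥ m(x); the remaining k coordinates are ≥ m(x').
  sum-lower-bound : mOf x + k * mOf x' ≤ uOf x'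
  sum-lower-bound = begin
    mOf x + k * mOf x'               ≤⟨ +-monoˡ-≤ _ (subst (mOf x ≤_) (sym kept) (minF-le (coords x) i)) ⟩
    x' (suc i) + k * mOf x'          ≤⟨ sum-lower (coords x') i (mOf x') (λ j _ → minF-le (coords x') j) ⟩
    sumF (coords x')                 ≤⟨ m≤n+m _ (x' zero) ⟩
    uOf x'                           ∎
    where open ≤-Reasoning

  -- Where x' attains its minimum, at least m(x) - m(x') was removed.
  sum-upper-bound : uOf x' + (mOf x ∸ mOf x') ≤ uOf x
  sum-upper-bound with argmin (coords x')
  ... | j , x'j≡min = begin
    x' zero + sumF (coords x') + (mOf x ∸ mOf x')  ≡⟨ +-assoc (x' zero) _ _ ⟩
    x' zero + (sumF (coords x') + (mOf x ∸ mOf x')) ≤⟨ +-mono-≤ (x'≤x zero) (+-monoʳ-≤ _ gap≤) ⟩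
    x zero + (sumF (coords x') + (x (suc j) ∸ x' (suc j))) ≤⟨ +-monoʳ-≤ (x zero) (sum-drop (coords x') (coords x) (x'≤x ∘ suc) j) ⟩
    uOf x                                          ∎
    where
      open ≤-Reasoning
      gap≤ : mOf x ∸ mOf x' ≤ x (suc j) ∸ x' (suc j)
      gap≤ = subst (λ z → mOf x ∸ mOf x' ≤ x (suc j) ∸ z) (sym x'j≡min)
                   (∸-monoˡ-≤ (mOf x') (minF-le (coords x) j))

  -- If u(x) = n m(x), keeping the minimum would leave no room to decrease u.
  strict-if-tight : yOf x ≡ 0 → mOf x' < mOf x
  strict-if-tight y≡0 with mOf x' <? mOf x
  ... | yes lt = lt
  ... | no ¬lt = contradiction (≤-trans u'<u (begin
    uOf x                 ≤⟨ m∸n≡0⇒m≤n y≡0 ⟩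
    suc k * mOf x         ≤⟨ +-monoʳ-≤ (mOf x) (*-monoʳ-≤ k (≮⇒≥ ¬lt)) ⟩
    mOf x + k * mOf x'    ≤⟨ sum-lower-bound ⟩
    uOf x'                ∎)) (<-irrefl refl)
    where open ≤-Reasoning

  admissible : Admissible (suc k) x (mOf x') (uOf x')
  admissible =
    (min-decreases , strict-if-tight) ,
    (sum-lower-bound ,
     max-bound-intro (uOf x') _ (uOf x) u'<u sum-upper-bound)

necessary : (x : Position (suc k)) (m u : ℕ) → InL x m u → Admissible (suc k) x m u
necessary x .(mOf x') .(uOf x') (x' , legal , refl , refl) = Necessity.admissible x x' legal

-- The basic construction: keep coordinate i, lower coordinate l ≠ i to m and
-- distribute the remaining total between the profiles
--   lo = (0, m, …, m, tᵢ, m, …, m)  and  hi = (x₀, t₁, …, m, …, tₙ)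
-- (tᵢ at position i, resp. m at position l).
moveKeeping : (x : Position (suc k)) (i l : Fin (suc k)) → i ≢ l → (m u : ℕ) →
              m ≤ mOf x → x (suc i) + k * m ≤ u →
              u + (x (suc l) ∸ m) ≤ uOf x → u < uOf x → InL x m u
moveKeeping {k} x i l i≢l m u m≤min lower room u<U =
  x' , (x'≤x , x'<x , i , kept) , min≡m , Σx'≡u
  where
    t : Fin (suc k) → ℕ
    t = coords x
    m≤t : ∀ a → m ≤ t a
    m≤t a = ≤-trans m≤min (minF-le t a)
    lo hi : Position (suc k)
    lo = 0 ∷ ((λ _ → m) [ i ]≔ t i)
    hi = x zero ∷ (t [ l ]≔ m)
    lo≤hi : ∀ a → lo a ≤ hi a
    lo≤hi zero    = z≤n
    lo≤hi (suc a) = updated-all (λ b v → v ≤ hi (suc b)) (λ _ → m) i (t i)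
      (≤-reflexive (sym (updateAt-minimal i l t i≢l)))
      (λ b _ → updated-all (λ _ v → m ≤ v) t l m ≤-refl (λ c _ → m≤t c) b) a
    hi≤x : ∀ a → hi a ≤ x a
    hi≤x zero    = ≤-refl
    hi≤x (suc a) = updated-all (λ b v → v ≤ t b) t l m (m≤t l) (λ _ _ → ≤-refl) a
    Σlo≤u : sumF lo ≤ u
    Σlo≤u = subst (_≤ u) (sym (sum-update-const k m i (t i))) lower
    u≤Σhi : u ≤ sumF hi
    u≤Σhi = +-cancelʳ-≤ (t l ∸ m) u (sumF hi) (subst (u + (t l ∸ m) ≤_)
      (trans (cong (x zero +_) (sym (sum-lowered t l m (m≤t l)))) (sym (+-assoc (x zero) _ _))) room)
    filled : ∃[ f ] (∀ a → lo a ≤ f a) × (∀ a → f a ≤ hi a) × sumF f ≡ u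
    filled = fill lo hi lo≤hi u Σlo≤u u≤Σhi
    x' : Position (suc k)
    x' = proj₁ filled
    lo≤x' : ∀ a → lo a ≤ x' a
    lo≤x' = proj₁ (proj₂ filled)
    x'≤hi : ∀ a → x' a ≤ hi a
    x'≤hi = proj₁ (proj₂ (proj₂ filled))
    Σx'≡u : uOf x' ≡ u
    Σx'≡u = proj₂ (proj₂ (proj₂ filled))
    x'≤x : ∀ a → x' a ≤ x a
    x'≤x a = ≤-trans (x'≤hi a) (hi≤x a)
    x'<x : uOf x' < uOf x
    x'<x = subst (_< uOf x) (sym Σx'≡u) u<U
    kept : x' (suc i) ≡ x (suc i)
    kept = ≤-antisym (x'≤x (suc i))
      (subst (_≤ x' (suc i)) (updateAt-updates i (λ _ → m)) (lo≤x' (suc i)))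
    min≡m : mOf x' ≡ m
    min≡m = ≤-antisym
      (≤-trans (minF-le (coords x') l) (subst (x' (suc l) ≤_) (updateAt-updates l t) (x'≤hi (suc l))))
      (minF-glb (coords x') m (λ a → ≤-trans
        (updated-all (λ _ v → m ≤ v) (λ _ → m) i (t i) (m≤t i) (λ _ _ → ≤-refl) a) (lo≤x' (suc a))))

-- The arithmetic of the second case of sufficiency, where n = p + 3 ≥ 3 is needed:
-- from m ≤ M ≤ s, M + (p+2)s ≤ U and U < u + (s - m) it follows that s + (p+2)m ≤ u.
second-case-bound : ∀ p m M s U u → m ≤ M → M ≤ s →
                    M + suc (suc p) * s ≤ U → U < u + (s ∸ m) → s + suc (suc p) * m ≤ u
second-case-bound p m M s U u m≤M M≤s big gap = <⇒≤ (+-cancelʳ-< s _ _ (begin-strict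
  s + suc (suc p) * m + s    ≡⟨ solve 3 (λ p m s → s :+ (con 2 :+ p) :* m :+ s := (m :+ p :* m) :+ (s :+ s :+ m)) refl p m s ⟩
  m + p * m + (s + s + m)    ≤⟨ +-monoˡ-≤ _ (+-mono-≤ m≤M (*-monoʳ-≤ p m≤s)) ⟩
  M + p * s + (s + s + m)    ≡⟨ solve 4 (λ p m s M → M :+ p :* s :+ (s :+ s :+ m) := M :+ (con 2 :+ p) :* s :+ m) refl p m s M ⟩
  M + suc (suc p) * s + m    ≤⟨ +-monoˡ-≤ m big ⟩
  U + m                      <⟨ +-monoˡ-< m gap ⟩
  u + (s ∸ m) + m            ≡⟨ +-assoc u _ m ⟩
  u + (s ∸ m + m)            ≡⟨ cong (u +_) (m∸n+n≡m m≤s) ⟩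
  u + s                      ∎))
  where
    open ≤-Reasoning
    m≤s : m ≤ s
    m≤s = ≤-trans m≤M M≤s

-- Sufficiency for n = p + 3: keep the minimal coordinate a and lower the
-- second smallest b to m if that leaves enough room; otherwise keep b and
-- lower a.
sufficient : (p : ℕ) (x : Position (suc (suc (suc p)))) (m u : ℕ) →
             Admissible (suc (suc (suc p))) x m u → InL x m u
sufficient p x m u ((m≤M , _) , (lower , upper)) = keepOrLower (argmin (coords x))
  where
    u<U : u < uOf x
    u<U = max-bound-strict u (mOf x ∸ m) (uOf x) upper
    u+gap≤U : u + (mOf x ∸ m) ≤ uOf x
    u+gap≤U = max-bound-gap u (mOf x ∸ m) (uOf x) upper

    keepOrLower : ∃[ a ] x (suc a) ≡ mOf x → InL x m u
    keepOrLower (a , ta≡M) with argmin-except (coords x) a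
    ... | b , b≢a , b-smallest with u + (x (suc b) ∸ m) ≤? uOf x
    ... | yes room = moveKeeping x a b (b≢a ∘ sym) m u m≤M
                       (subst (λ z → z + _ ≤ u) (sym ta≡M) lower) room u<U
    ... | no no-room = moveKeeping x b a b≢a m u m≤M
                         (second-case-bound p m (mOf x) (x (suc b)) (uOf x) u m≤M
                            (minF-le (coords x) b) M+ks≤U (≰⇒> no-room))
                         (subst (λ z → u + (z ∸ m) ≤ uOf x) (sym ta≡M) u+gap≤U) u<U
      where
        -- all coordinates but the minimal one are at least x_b
        M+ks≤U : mOf x + suc (suc p) * x (suc b) ≤ uOf x
        M+ks≤U = ≤-trans (+-monoˡ-≤ _ (≤-reflexive (sym ta≡M)))
                   (≤-trans (sum-lower (coords x) a (x (suc b)) b-smallest) (m≤n+m _ (x zero)))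

lemma3p2 : (n : ℕ) → 3 ≤ n → (x : Position n) → (m u : ℕ) →
    InL x m u ⇔
      ((m ≤ mOf x × (yOf x ≡ 0 → m < mOf x))
       × (mOf x + (n ∸ 1) * m ≤ u × u + (1 ⊔ (mOf x ∸ m)) ≤ uOf x))
lemma3p2 (suc (suc (suc p))) (s≤s (s≤s (s≤s z≤n))) x m u = mk⇔ (necessary x m u) (sufficient p x m u)
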